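{- Let $\mathcal D_{n,\sigma}=\bigcup_m\mathcal D_{n,m,\sigma}$. Then: (1) for any $n$ and $\sigma\le n-1$, $\log|\mathcal D_{n,\sigma}|\ge n\sigma+(n-\sigma)\log\sigma-(n+\log\sigma)$; (2) for any constant $\varepsilon\in(0,1/2]$, for all $n\ge 2/\varepsilon$ and $\sigma\le(1-\varepsilon)n$, $\log|\mathcal D_{n,\sigma}|\le n\sigma+(n-\sigma)\log\sigma+O(n)$.
   Context: $\log$ is base 2. For a positive integer $k$, $[k]=\{1,\dots,k\}$. A DFA is a triple $D=(Q,\Sigma,\delta)$ with $Q=[n]$, source state $1$, alphabet $\Sigma=[\sigma]$ ordered as integers, and partial transition function $\delta:Q\times\Sigma\to Q$ (not necessarily complete); $m$ is the number of pairs on which $\delta$ is defined. DFAs are assumed to satisfy: state $v$ has at least one incoming transition iff $v>1$; they need not be connected. The alphabet is effective if every letter of $[\sigma]$ labels some transition. A DFA is Wheeler with respect to $1<\dots<n$ if: (i) whenever $u'=\delta(u,a)$, $v'=\delta(v,a')$ and $a<a'$, then $u'<v'$; (ii) whenever $u'=\delta(u,a)\ne\delta(v,a)=v'$ and $u<v$, then $u'<v'$. $\mathcal D_{n,m,\sigma}$ denotes the set of all such WDFAs with states $[n]$, exactly $m$ transitions and effective alphabet $[\sigma]$; thus $\mathcal D_{n,\sigma}$ is the set of all WDFAs with states $[n]$, effective alphabet $[\sigma]$ and Wheeler order $1<\dots<n$, with any number of transitions. The constant in $O(n)$ may depend on $\varepsilon$.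
   Formalization: The constant ε of part (2) ranges only over the rationals in $(0,1/2]$. -}

module Defs where

open import Data.Nat using (ℕ; zero; suc; _+_; _*_; _∸_; _^_; _≤_)
open import Data.Bool using (Bool; true; false; _∧_; _∨_; not; if_then_else_)
open import Data.Fin using (Fin; zero; suc; toℕ)
open import Data.Fin.Properties using (_≟_)
open import Data.Maybe using (Maybe; just; nothing)
open import Data.List using (List; []; _∷_; map; concatMap; length; filter)
open import Data.Vec using (Vec; []; _∷_; lookup)
open import Relation.Nullary.Decidable using (⌊_⌋)
open import Data.Nat.Properties using () renaming (_<?_ to _<ℕ?_)
open import Relation.Binary.PropositionalEquality using (_≡_)
open import Data.Bool.Properties using () renaming (_≟_ to _≟B_)

-- States [n] are represented by Fin n (state i+1 ↔ index i; source state 1 ↔ zero).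
-- Letters [σ] are represented by Fin σ (letter a+1 ↔ index a), ordered as integers.
-- A partial transition function δ : Q × Σ → Q is a table
--   Vec (Vec (Maybe (Fin n)) σ) n,  δ u a = nothing  means undefined.
-- Two DFAs with the same state set / alphabet are equal iff their tables are equal.

Trans : ℕ → ℕ → Set
Trans n σ = Vec (Vec (Maybe (Fin n)) σ) n

δ : ∀ {n σ} → Trans n σ → Fin n → Fin σ → Maybe (Fin n)
δ t u a = lookup (lookup t u) a

allFinL : (k : ℕ) → List (Fin k)
allFinL zero = []
allFinL (suc k) = zero ∷ map suc (allFinL k)

allB : {A : Set} → (A → Bool) → List A → Bool
allB p [] = true
allB p (x ∷ xs) = p x ∧ allB p xs

anyB : {A : Set} → (A → Bool) → List A → Bool
anyB p [] = false
anyB p (x ∷ xs) = p x ∨ anyB p xs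

∀F : (k : ℕ) → (Fin k → Bool) → Bool
∀F k p = allB p (allFinL k)

∃F : (k : ℕ) → (Fin k → Bool) → Bool
∃F k p = anyB p (allFinL k)

_<F_ : ∀ {k} → Fin k → Fin k → Bool
i <F j = ⌊ toℕ i <ℕ? toℕ j ⌋

_=F_ : ∀ {k} → Fin k → Fin k → Bool
i =F j = ⌊ i ≟ j ⌋

_⇒B_ : Bool → Bool → Bool
p ⇒B q = not p ∨ q

_⇔B_ : Bool → Bool → Bool
p ⇔B q = (p ⇒B q) ∧ (q ⇒B p)

_↦_ : ∀ {n} → Maybe (Fin n) → Fin n → Bool
just w ↦ v = w =F v
nothing ↦ v = false

isDefined : ∀ {n} → Maybe (Fin n) → Bool
isDefined (just _) = true
isDefined nothing = false

isZero : ∀ {k} → Fin k → Bool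
isZero zero = true
isZero (suc _) = false

incomingOK : ∀ {n σ} → Trans n σ → Bool
incomingOK {n} {σ} t =
  ∀F n λ v → not (isZero v) ⇔B (∃F n λ u → ∃F σ λ a → δ t u a ↦ v)

effective : ∀ {n σ} → Trans n σ → Bool
effective {n} {σ} t = ∀F σ λ a → ∃F n λ u → isDefined (δ t u a)

wheeler1 : ∀ {n σ} → Trans n σ → Bool
wheeler1 {n} {σ} t =
  ∀F n λ u → ∀F n λ v → ∀F σ λ a → ∀F σ λ a' → ∀F n λ u' → ∀F n λ v' →
    ((δ t u a ↦ u') ∧ (δ t v a' ↦ v') ∧ (a <F a')) ⇒B (u' <F v')

wheeler2 : ∀ {n σ} → Trans n σ → Bool
wheeler2 {n} {σ} t =
  ∀F n λ u → ∀F n λ v → ∀F σ λ a → ∀F n λ u' → ∀F n λ v' →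
    ((δ t u a ↦ u') ∧ (δ t v a ↦ v') ∧ not (u' =F v') ∧ (u <F v)) ⇒B (u' <F v')

-- Membership in D_{n,σ}: a WDFA on states [n], effective alphabet [σ],
-- Wheeler w.r.t. 1 < ... < n, any number of transitions.
isWDFA : ∀ {n σ} → Trans n σ → Bool
isWDFA t = incomingOK t ∧ effective t ∧ wheeler1 t ∧ wheeler2 t

allVecs : {A : Set} → List A → (k : ℕ) → List (Vec A k)
allVecs xs zero = [] ∷ []
allVecs xs (suc k) = concatMap (λ x → map (x ∷_) (allVecs xs k)) xs

allMaybeFin : (n : ℕ) → List (Maybe (Fin n))
allMaybeFin n = nothing ∷ map just (allFinL n)

allTrans : (n σ : ℕ) → List (Trans n σ)
allTrans n σ = allVecs (allVecs (allMaybeFin n) σ) n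

countWDFA : ℕ → ℕ → ℕ
countWDFA n σ = length (filter (λ t → isWDFA t ≟B true) (allTrans n σ))

module Submission where

-- Upper bound: list the transitions column by column (letter by letter, and within a letter
-- state by state). Wheeler's axioms make the defined targets of a WDFA non-decreasing along
-- this list, and since its targets are exactly the non-source states, each one exceeds the
-- previous by 0 or 1. So a WDFA is determined by which transitions are defined (nσ bits) and
-- at which transitions the target increases. The first target of each letter always
-- increases, which leaves at most n − 1 − σ free increases; a 0/1 matrix with at most k ones
-- is determined by n + k bits and k letters, giving 2^(nσ) · 2^(n + k) · σ^k WDFAs at most.
--
-- Lower bound: take the source row complete, give each of the next n − 1 − σ rows one forced
-- letter, and choose every other definedness bit freely. Sending each transition into a block
-- of states reserved for its letter, at the offset given by the forced occurrences of that
-- letter so far, yields a WDFA; the forced letters can be read back from the targets, so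
-- distinct choices give distinct WDFAs.

open import Defs
open import Data.Bool using (Bool; true; false; _∧_; not; if_then_else_)
open import Data.Bool.Properties using () renaming (_≟_ to _≟B_)
open import Data.Empty using (⊥-elim)
open import Data.Fin using (Fin; zero; suc; toℕ; fromℕ<; _↑ˡ_)
import Data.Fin.Properties as Fin
open import Data.List
  using (List; []; _∷_; length; map; _++_; replicate; concatMap; cartesianProduct; cartesianProductWith; filter)
import Data.List.Properties as List
open import Data.List.Membership.Propositional using (_∈_)
open import Data.List.Membership.Propositional.Properties
  using (∈-∃++; ∈-++⁻; ∈-++⁺ˡ; ∈-++⁺ʳ; ∈-map⁺; ∈-map⁻; ∈-filter⁺; ∈-filter⁻; ∈-cartesianProduct⁺;
         ∈-cartesianProductWith⁺)
open import Data.List.Relation.Unary.Any using (here; there)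
import Data.List.Relation.Unary.All as ListAll
open ListAll using ([]; _∷_)
open import Data.List.Relation.Unary.Unique.Propositional using (Unique; []; _∷_)
import Data.List.Relation.Unary.Unique.Propositional.Properties as Unique
open import Data.Maybe using (Maybe; just; nothing; is-just)
import Data.Maybe as Maybe
import Data.Maybe.Properties as Maybe
open import Data.Nat using (ℕ; zero; suc; pred; _+_; _*_; _∸_; _^_; _≤_; _<_; z≤n; s≤s)
open import Data.Nat.Properties
open import Data.Nat.Tactic.RingSolver using (solve-∀)
open import Data.Product using (_×_; _,_; proj₁; proj₂; ∃; ∃₂; Σ)
open import Data.Product.Properties using (,-injective)
open import Data.Sum using (_⊎_; inj₁; inj₂)
open import Data.Unit using (⊤)
open import Data.Vec using (Vec; []; _∷_; lookup; tabulate; zipWith; insertAt; removeAt; concat; toList)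
import Data.Vec as Vec
import Data.Vec.Properties as Vec
import Data.Vec.Membership.Propositional.Properties as Vec
open import Data.Vec.Membership.Propositional using () renaming (_∈_ to _∈ᵥ_)
open import Data.Vec.Relation.Unary.Any using (here; there)
import Data.Vec.Relation.Unary.Any.Properties as Any
open import Data.Vec.Relation.Unary.All using (All; []; _∷_)
import Data.Vec.Relation.Unary.All as All
import Data.Vec.Relation.Unary.All.Properties as All
open import Data.Vec.Relation.Unary.AllPairs using (AllPairs; []; _∷_)
import Data.Vec.Relation.Unary.AllPairs.Properties as AllPairs
open import Function using (_∘_; case_of_)
open import Relation.Nullary using (does; yes; no)
open import Relation.Nullary.Decidable using (dec-true; dec-false)
open import Relation.Binary.PropositionalEquality
open import Algebra.Properties.CommutativeMonoid.Sum +-0-commutativeMonoid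
  using (sum-syntax; sum-cong-≗; ∑-comm)

-- Boolean reflection of the Wheeler conditions

∧-true⁻ : ∀ {a b} → a ∧ b ≡ true → a ≡ true × b ≡ true
∧-true⁻ {true} {true} _ = refl , refl

∧-true⁺ : ∀ {a b} → a ≡ true → b ≡ true → a ∧ b ≡ true
∧-true⁺ refl refl = refl

⇒B-true⁻ : ∀ {p q} → (p ⇒B q) ≡ true → p ≡ true → q ≡ true
⇒B-true⁻ {true} {true} _ _ = refl

⇒B-true⁺ : ∀ {p q} → (p ≡ true → q ≡ true) → (p ⇒B q) ≡ true
⇒B-true⁺ {true} h = h refl
⇒B-true⁺ {false} h = refl

⇔B-true⁻ : ∀ {p q} → (p ⇔B q) ≡ true → p ≡ q
⇔B-true⁻ {true} {true} _ = refl
⇔B-true⁻ {false} {false} _ = refl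

⇔B-true⁺ : ∀ {p q} → p ≡ q → (p ⇔B q) ≡ true
⇔B-true⁺ {true} refl = refl
⇔B-true⁺ {false} refl = refl

allB-true⁻ : ∀ {A : Set} {p : A → Bool} xs → allB p xs ≡ true → ∀ {x} → x ∈ xs → p x ≡ true
allB-true⁻ (y ∷ xs) e (here refl) = proj₁ (∧-true⁻ e)
allB-true⁻ (y ∷ xs) e (there x∈xs) = allB-true⁻ xs (proj₂ (∧-true⁻ e)) x∈xs

allB-true⁺ : ∀ {A : Set} {p : A → Bool} xs → (∀ x → p x ≡ true) → allB p xs ≡ true
allB-true⁺ [] h = refl
allB-true⁺ (x ∷ xs) h = ∧-true⁺ (h x) (allB-true⁺ xs h)

anyB-true⁻ : ∀ {A : Set} {p : A → Bool} xs → anyB p xs ≡ true → ∃ λ x → p x ≡ true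
anyB-true⁻ {p = p} (y ∷ xs) e with p y in py
... | true = y , py
... | false = anyB-true⁻ xs e

anyB-true⁺ : ∀ {A : Set} {p : A → Bool} xs {x} → x ∈ xs → p x ≡ true → anyB p xs ≡ true
anyB-true⁺ {p = p} (y ∷ xs) (here refl) e rewrite e = refl
anyB-true⁺ {p = p} (y ∷ xs) (there x∈xs) e with p y
... | true = refl
... | false = anyB-true⁺ xs x∈xs e

anyB-false⁺ : ∀ {A : Set} {p : A → Bool} xs → (∀ x → p x ≡ false) → anyB p xs ≡ false
anyB-false⁺ [] h = refl
anyB-false⁺ (x ∷ xs) h rewrite h x = anyB-false⁺ xs h

∈-allFinL : ∀ {k} (i : Fin k) → i ∈ allFinL k
∈-allFinL zero = here refl
∈-allFinL (suc i) = there (∈-map⁺ suc (∈-allFinL i))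

∀F-true⁻ : ∀ {k} {p : Fin k → Bool} → ∀F k p ≡ true → ∀ i → p i ≡ true
∀F-true⁻ {k} e i = allB-true⁻ (allFinL k) e (∈-allFinL i)

∀F-true⁺ : ∀ {k} {p : Fin k → Bool} → (∀ i → p i ≡ true) → ∀F k p ≡ true
∀F-true⁺ {k} = allB-true⁺ (allFinL k)

∃F-true⁻ : ∀ {k} {p : Fin k → Bool} → ∃F k p ≡ true → ∃ λ i → p i ≡ true
∃F-true⁻ {k} = anyB-true⁻ (allFinL k)

∃F-true⁺ : ∀ {k} {p : Fin k → Bool} i → p i ≡ true → ∃F k p ≡ true
∃F-true⁺ {k} i = anyB-true⁺ (allFinL k) (∈-allFinL i)

∃F-false⁺ : ∀ {k} {p : Fin k → Bool} → (∀ i → p i ≡ false) → ∃F k p ≡ false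
∃F-false⁺ {k} = anyB-false⁺ (allFinL k)

=F-true⁻ : ∀ {k} {i j : Fin k} → (i =F j) ≡ true → i ≡ j
=F-true⁻ {i = i} {j} e with i Fin.≟ j
... | yes i≡j = i≡j

=F-false⁺ : ∀ {k} {i j : Fin k} → i ≢ j → (i =F j) ≡ false
=F-false⁺ {i = i} {j} i≢j with i Fin.≟ j
... | yes i≡j = ⊥-elim (i≢j i≡j)
... | no _ = refl

=F-refl : ∀ {k} (i : Fin k) → (i =F i) ≡ true
=F-refl i with i Fin.≟ i
... | yes _ = refl
... | no i≢i = ⊥-elim (i≢i refl)

<F-true⁻ : ∀ {k} {i j : Fin k} → (i <F j) ≡ true → toℕ i < toℕ j
<F-true⁻ {i = i} {j} e with toℕ i <? toℕ j
... | yes i<j = i<j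

<F-true⁺ : ∀ {k} {i j : Fin k} → toℕ i < toℕ j → (i <F j) ≡ true
<F-true⁺ {i = i} {j} i<j with toℕ i <? toℕ j
... | yes _ = refl
... | no i≮j = ⊥-elim (i≮j i<j)

↦-true⁻ : ∀ {n} {m : Maybe (Fin n)} {v} → (m ↦ v) ≡ true → m ≡ just v
↦-true⁻ {m = just w} e = cong just (=F-true⁻ e)

↦-true⁺ : ∀ {n} {m : Maybe (Fin n)} {v} → m ≡ just v → (m ↦ v) ≡ true
↦-true⁺ {v = v} refl = =F-refl v

↦-false⁺ : ∀ {n} {m : Maybe (Fin n)} {v} → m ≢ just v → (m ↦ v) ≡ false
↦-false⁺ {m = nothing} _ = refl
↦-false⁺ {m = just w} m≢v = =F-false⁺ (λ w≡v → m≢v (cong just w≡v))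

isDefined-true⁻ : ∀ {n} {m : Maybe (Fin n)} → isDefined m ≡ true → ∃ λ v → m ≡ just v
isDefined-true⁻ {m = just v} _ = v , refl

record Wheeler {n σ} (t : Trans n σ) : Set where
  field
    order-letters : ∀ {u v a a' u' v'} → δ t u a ≡ just u' → δ t v a' ≡ just v' →
      toℕ a < toℕ a' → toℕ u' < toℕ v'
    order-states : ∀ {u v a u' v'} → δ t u a ≡ just u' → δ t v a ≡ just v' → u' ≢ v' →
      toℕ u < toℕ v → toℕ u' < toℕ v'
    letter-used : ∀ a → ∃₂ λ u v → δ t u a ≡ just v
    source-unreached : ∀ {u a v} → δ t u a ≡ just v → 0 < toℕ v
    nonsource-reached : ∀ v → 0 < toℕ v → ∃₂ λ u a → δ t u a ≡ just v

isWDFA⇒Wheeler : ∀ {n σ} {t : Trans n σ} → isWDFA t ≡ true → Wheeler t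
isWDFA⇒Wheeler {n} {σ} {t} valid = record
  { order-letters = λ {u} {v} {a} {a'} {u'} {v'} δua δva' a<a' → <F-true⁻ (⇒B-true⁻
      (∀F-true⁻ (∀F-true⁻ (∀F-true⁻ (∀F-true⁻ (∀F-true⁻ (∀F-true⁻ w1 u) v) a) a') u') v')
      (∧-true⁺ (↦-true⁺ δua) (∧-true⁺ (↦-true⁺ δva') (<F-true⁺ a<a'))))
  ; order-states = λ {u} {v} {a} {u'} {v'} δua δva u'≢v' u<v → <F-true⁻ (⇒B-true⁻
      (∀F-true⁻ (∀F-true⁻ (∀F-true⁻ (∀F-true⁻ (∀F-true⁻ w2 u) v) a) u') v')
      (∧-true⁺ (↦-true⁺ δua) (∧-true⁺ (↦-true⁺ δva)
        (∧-true⁺ (cong not (=F-false⁺ u'≢v')) (<F-true⁺ u<v)))))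
  ; letter-used = λ a → defined (∃F-true⁻ (∀F-true⁻ eff a))
  ; source-unreached = λ {u} {a} {v} δua →
      nonsource v (trans (incoming v) (∃F-true⁺ u (∃F-true⁺ a (↦-true⁺ δua))))
  ; nonsource-reached = λ v 0<v → reached (∃F-true⁻ (trans (sym (incoming v)) (source v 0<v)))
  }
  where
  inc : incomingOK t ≡ true
  inc = proj₁ (∧-true⁻ {incomingOK t} valid)
  rest : effective t ∧ wheeler1 t ∧ wheeler2 t ≡ true
  rest = proj₂ (∧-true⁻ {incomingOK t} valid)
  eff : effective t ≡ true
  eff = proj₁ (∧-true⁻ {effective t} rest)
  w1 : wheeler1 t ≡ true
  w1 = proj₁ (∧-true⁻ {wheeler1 t} (proj₂ (∧-true⁻ {effective t} rest)))
  w2 : wheeler2 t ≡ true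
  w2 = proj₂ (∧-true⁻ {wheeler1 t} (proj₂ (∧-true⁻ {effective t} rest)))

  incoming : ∀ v → not (isZero v) ≡ (∃F n λ u → ∃F σ λ a → δ t u a ↦ v)
  incoming v = ⇔B-true⁻ (∀F-true⁻ inc v)

  nonsource : ∀ (v : Fin n) → not (isZero v) ≡ true → 0 < toℕ v
  nonsource (suc v) _ = s≤s z≤n

  source : ∀ (v : Fin n) → 0 < toℕ v → not (isZero v) ≡ true
  source (suc v) _ = refl

  defined : ∀ {a} → (∃ λ u → isDefined (δ t u a) ≡ true) → ∃₂ λ u v → δ t u a ≡ just v
  defined (u , e) = u , isDefined-true⁻ e

  reached : ∀ {v} → (∃ λ u → (∃F σ λ a → δ t u a ↦ v) ≡ true) →
    ∃₂ λ u a → δ t u a ≡ just v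
  reached (u , e) with ∃F-true⁻ e
  ... | a , δua = u , a , ↦-true⁻ δua

Wheeler⇒isWDFA : ∀ {n σ} {t : Trans n σ} → Wheeler t → isWDFA t ≡ true
Wheeler⇒isWDFA {n} {σ} {t} W =
  ∧-true⁺ (∀F-true⁺ λ v → ⇔B-true⁺ (incoming v))
    (∧-true⁺ (∀F-true⁺ λ a → used (letter-used a))
      (∧-true⁺
        (∀F-true⁺ λ u → ∀F-true⁺ λ v → ∀F-true⁺ λ a → ∀F-true⁺ λ a' →
          ∀F-true⁺ λ u' → ∀F-true⁺ λ v' → ⇒B-true⁺ (letters u v a a' u' v'))
        (∀F-true⁺ λ u → ∀F-true⁺ λ v → ∀F-true⁺ λ a →
          ∀F-true⁺ λ u' → ∀F-true⁺ λ v' → ⇒B-true⁺ (states u v a u' v'))))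
  where
  open Wheeler W

  distinct : ∀ {u' v' : Fin n} → not (u' =F v') ≡ true → u' ≢ v'
  distinct {u'} e refl rewrite =F-refl u' = case e of λ ()

  letters : ∀ u v a a' u' v' → ((δ t u a ↦ u') ∧ (δ t v a' ↦ v') ∧ (a <F a')) ≡ true →
    (u' <F v') ≡ true
  letters u v a a' u' v' c with ∧-true⁻ c
  ... | δua , c' with ∧-true⁻ c'
  ...   | δva' , a<a' = <F-true⁺ (order-letters (↦-true⁻ δua) (↦-true⁻ δva') (<F-true⁻ a<a'))

  states : ∀ u v a u' v' → ((δ t u a ↦ u') ∧ (δ t v a ↦ v') ∧ not (u' =F v') ∧ (u <F v)) ≡ true →
    (u' <F v') ≡ true
  states u v a u' v' c with ∧-true⁻ c
  ... | δua , c' with ∧-true⁻ c'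
  ...   | δva , c'' with ∧-true⁻ c''
  ...     | u'≢v' , u<v =
    <F-true⁺ (order-states (↦-true⁻ δua) (↦-true⁻ δva) (distinct u'≢v') (<F-true⁻ u<v))

  used : ∀ {a} → (∃₂ λ u v → δ t u a ≡ just v) → (∃F n λ u → isDefined (δ t u a)) ≡ true
  used (u , v , δua) = ∃F-true⁺ u (cong isDefined δua)

  unreached : ∀ v → toℕ v ≡ 0 → (∃F n λ u → ∃F σ λ a → δ t u a ↦ v) ≡ false
  unreached v v≡0 = ∃F-false⁺ {n} λ u → ∃F-false⁺ {σ} λ a → ↦-false⁺ λ δua →
    n≮0 (subst (0 <_) v≡0 (source-unreached δua))

  incoming : ∀ v → not (isZero v) ≡ (∃F n λ u → ∃F σ λ a → δ t u a ↦ v)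
  incoming zero = sym (unreached zero refl)
  incoming (suc v) with nonsource-reached (suc v) (s≤s z≤n)
  ... | u , a , δua = sym (∃F-true⁺ u (∃F-true⁺ a (↦-true⁺ δua)))

-- Counting by injections

length-≤-of-injection : ∀ {A B : Set} (f : A → B) {xs : List A} {ys : List B} → Unique xs →
  (∀ {x y} → x ∈ xs → y ∈ xs → f x ≡ f y → x ≡ y) → (∀ {x} → x ∈ xs → f x ∈ ys) →
  length xs ≤ length ys
length-≤-of-injection f {[]} _ _ _ = z≤n
length-≤-of-injection f {x ∷ xs} (x∉xs ∷ unique) inj into with ∈-∃++ (into (here refl))
... | ys₁ , ys₂ , refl = begin
    suc (length xs)                ≤⟨ s≤s (length-≤-of-injection f unique (λ p q → inj (there p) (there q)) into′) ⟩
    suc (length (ys₁ ++ ys₂))      ≡⟨ cong suc (List.length-++ ys₁) ⟩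
    suc (length ys₁ + length ys₂)  ≡⟨ +-suc (length ys₁) (length ys₂) ⟨
    length ys₁ + suc (length ys₂)  ≡⟨ List.length-++ ys₁ ⟨
    length (ys₁ ++ f x ∷ ys₂)      ∎
  where
  open ≤-Reasoning
  into′ : ∀ {y} → y ∈ xs → f y ∈ ys₁ ++ ys₂
  into′ {y} y∈xs with ∈-++⁻ ys₁ (into (there y∈xs))
  ... | inj₁ p = ∈-++⁺ˡ p
  ... | inj₂ (here fy≡fx) = ⊥-elim (ListAll.lookup x∉xs y∈xs (sym (inj (there y∈xs) (here refl) fy≡fx)))
  ... | inj₂ (there p) = ∈-++⁺ʳ ys₁ p

length-cartesianProductWith : ∀ {A B C : Set} (f : A → B → C) xs ys →
  length (cartesianProductWith f xs ys) ≡ length xs * length ys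
length-cartesianProductWith f [] ys = refl
length-cartesianProductWith f (x ∷ xs) ys = begin
  length (map (f x) ys ++ cartesianProductWith f xs ys)
    ≡⟨ List.length-++ (map (f x) ys) ⟩
  length (map (f x) ys) + length (cartesianProductWith f xs ys)
    ≡⟨ cong₂ _+_ (List.length-map (f x) ys) (length-cartesianProductWith f xs ys) ⟩
  length ys + length xs * length ys ∎
  where open ≡-Reasoning

allVecs-suc : ∀ {A : Set} (xs : List A) k →
  allVecs xs (suc k) ≡ cartesianProductWith Vec._∷_ xs (allVecs xs k)
allVecs-suc xs k = go xs
  where
  go : ∀ zs → concatMap (λ z → map (z Vec.∷_) (allVecs xs k)) zs ≡
    cartesianProductWith Vec._∷_ zs (allVecs xs k)
  go [] = refl
  go (z ∷ zs) = cong (map (z Vec.∷_) (allVecs xs k) ++_) (go zs)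

≡-from-lookup : ∀ {A : Set} {m} {xs ys : Vec A m} → (∀ i → lookup xs i ≡ lookup ys i) → xs ≡ ys
≡-from-lookup {xs = xs} {ys} same =
  trans (sym (Vec.tabulate∘lookup xs)) (trans (Vec.tabulate-cong same) (Vec.tabulate∘lookup ys))

lookup²-tabulate : ∀ {A : Set} {m k} (f : Fin m → Fin k → A) i j →
  lookup (lookup (tabulate λ i → tabulate (f i)) i) j ≡ f i j
lookup²-tabulate f i j = trans (cong (λ r → lookup r j) (Vec.lookup∘tabulate (λ i → tabulate (f i)) i))
  (Vec.lookup∘tabulate (f i) j)

tabulate²-injective : ∀ {A : Set} {m k} {f g : Fin m → Fin k → A} →
  tabulate (λ i → tabulate (f i)) ≡ tabulate (λ i → tabulate (g i)) → ∀ i j → f i j ≡ g i j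
tabulate²-injective {f = f} {g} same i j = begin
  f i j                                                ≡⟨ lookup²-tabulate f i j ⟨
  lookup (lookup (tabulate λ i → tabulate (f i)) i) j  ≡⟨ cong (λ xss → lookup (lookup xss i) j) same ⟩
  lookup (lookup (tabulate λ i → tabulate (g i)) i) j  ≡⟨ lookup²-tabulate g i j ⟩
  g i j                                                ∎
  where open ≡-Reasoning

record Enumeration (A : Set) (size : ℕ) : Set where
  field
    elements : List A
    unique : Unique elements
    complete : ∀ x → x ∈ elements
    length-elements : length elements ≡ size

open Enumeration

Fin-enumeration : ∀ k → Enumeration (Fin k) k
Fin-enumeration k = record
  { elements = allFinL k
  ; unique = unique-allFinL k
  ; complete = ∈-allFinL
  ; length-elements = length-allFinL k
  }
  where
  unique-allFinL : ∀ k → Unique (allFinL k)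
  unique-allFinL zero = []
  unique-allFinL (suc k) = ListAll.tabulate zero∉ ∷ Unique.map⁺ Fin.suc-injective (unique-allFinL k)
    where
    zero∉ : ∀ {i} → i ∈ map suc (allFinL k) → zero ≢ i
    zero∉ p with ∈-map⁻ suc p
    ... | _ , _ , refl = λ ()
  length-allFinL : ∀ k → length (allFinL k) ≡ k
  length-allFinL zero = refl
  length-allFinL (suc k) = cong suc (trans (List.length-map suc (allFinL k)) (length-allFinL k))

Bool-enumeration : Enumeration Bool 2
Bool-enumeration = record
  { elements = true ∷ false ∷ []
  ; unique = ((λ ()) ∷ []) ∷ [] ∷ []
  ; complete = λ { true → here refl ; false → there (here refl) }
  ; length-elements = refl
  }

Maybe-enumeration : ∀ {A : Set} {k} → Enumeration A k → Enumeration (Maybe A) (suc k)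
Maybe-enumeration E = record
  { elements = nothing ∷ map just (elements E)
  ; unique = ListAll.tabulate nothing∉ ∷ Unique.map⁺ Maybe.just-injective (unique E)
  ; complete = λ { nothing → here refl ; (just x) → there (∈-map⁺ just (complete E x)) }
  ; length-elements = cong suc (trans (List.length-map just (elements E)) (length-elements E))
  }
  where
  nothing∉ : ∀ {m} → m ∈ map just (elements E) → nothing ≢ m
  nothing∉ p with ∈-map⁻ just p
  ... | _ , _ , refl = λ ()

×-enumeration : ∀ {A B : Set} {a b} → Enumeration A a → Enumeration B b → Enumeration (A × B) (a * b)
×-enumeration E F = record
  { elements = cartesianProduct (elements E) (elements F)
  ; unique = Unique.cartesianProduct⁺ (unique E) (unique F)
  ; complete = λ (x , y) → ∈-cartesianProduct⁺ (complete E x) (complete F y)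
  ; length-elements = trans (length-cartesianProductWith _,_ (elements E) (elements F))
      (cong₂ _*_ (length-elements E) (length-elements F))
  }

Vec-enumeration : ∀ {A : Set} {a} → Enumeration A a → ∀ k → Enumeration (Vec A k) (a ^ k)
Vec-enumeration {A} {a} E k = record
  { elements = allVecs (elements E) k
  ; unique = unique′ k
  ; complete = complete′
  ; length-elements = length′ k
  }
  where
  unique′ : ∀ k → Unique (allVecs (elements E) k)
  unique′ zero = [] ∷ []
  unique′ (suc k) = subst Unique (sym (allVecs-suc (elements E) k))
    (Unique.cartesianProductWith⁺ Vec._∷_ Vec.∷-injective (unique E) (unique′ k))
  complete′ : ∀ {k} (v : Vec A k) → v ∈ allVecs (elements E) k
  complete′ [] = here refl
  complete′ {suc k} (x ∷ v) = subst (_ ∈_) (sym (allVecs-suc (elements E) k))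
    (∈-cartesianProductWith⁺ Vec._∷_ (complete E x) (complete′ v))
  length′ : ∀ k → length (allVecs (elements E) k) ≡ a ^ k
  length′ zero = refl
  length′ (suc k) = begin
    length (allVecs (elements E) (suc k))
      ≡⟨ cong length (allVecs-suc (elements E) k) ⟩
    length (cartesianProductWith Vec._∷_ (elements E) (allVecs (elements E) k))
      ≡⟨ length-cartesianProductWith Vec._∷_ (elements E) _ ⟩
    length (elements E) * length (allVecs (elements E) k)
      ≡⟨ cong₂ _*_ (length-elements E) (length′ k) ⟩
    a * a ^ k ∎
    where open ≡-Reasoning

Trans-enumeration : ∀ n σ → Enumeration (Trans n σ) ((suc n ^ σ) ^ n)
Trans-enumeration n σ = Vec-enumeration (Vec-enumeration (Maybe-enumeration (Fin-enumeration n)) σ) n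

module _ {n σ : ℕ} where

  private
    isWDFA? = λ (t : Trans n σ) → isWDFA t ≟B true

  ≤-countWDFA : ∀ {A : Set} {c} → Enumeration A c → (f : A → Trans n σ) →
    (∀ {x y} → f x ≡ f y → x ≡ y) → (∀ x → isWDFA (f x) ≡ true) → c ≤ countWDFA n σ
  ≤-countWDFA E f f-injective f-wheeler = subst (_≤ countWDFA n σ) (length-elements E)
    (length-≤-of-injection f (unique E) (λ _ _ → f-injective)
      (λ {x} _ → ∈-filter⁺ isWDFA? (complete (Trans-enumeration n σ) (f x)) (f-wheeler x)))

  countWDFA-≤ : ∀ {B : Set} {c} → Enumeration B c → (code : Trans n σ → B) →
    (∀ {t t'} → isWDFA t ≡ true → isWDFA t' ≡ true → code t ≡ code t' → t ≡ t') →
    countWDFA n σ ≤ c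
  countWDFA-≤ E code code-injective = subst (countWDFA n σ ≤_) (length-elements E)
    (length-≤-of-injection code (Unique.filter⁺ isWDFA? (unique (Trans-enumeration n σ)))
      (λ p q → code-injective (wheeler p) (wheeler q)) (λ {t} _ → complete E (code t)))
    where
    wheeler : ∀ {t} → t ∈ filter isWDFA? (allTrans n σ) → isWDFA t ≡ true
    wheeler p = proj₂ (∈-filter⁻ isWDFA? {xs = allTrans n σ} p)

-- The lower bound family

crossing : ∀ (f : ℕ → ℕ) {x} m → f 0 ≤ x → x < f m →
  ∃ λ a → a < m × f a ≤ x × x < f (suc a)
crossing f zero f0≤x x<f0 = ⊥-elim (<-irrefl refl (≤-trans x<f0 f0≤x))
crossing f {x} (suc m) f0≤x x<fm₁ with x <? f m
... | yes x<fm = let (a , a<m , rest) = crossing f m f0≤x x<fm in a , m<n⇒m<1+n a<m , rest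
... | no x≮fm = m , ≤-refl , ≮⇒≥ x≮fm , x<fm₁

module Counting {σ : ℕ} where

  matches : ℕ → Fin σ → ℕ
  matches a x with toℕ x ≟ a
  ... | yes _ = 1
  ... | no _ = 0

  count : ∀ {m} → ℕ → Vec (Fin σ) m → ℕ
  count a [] = 0
  count a (x ∷ xs) = matches a x + count a xs

  countPrefix : ∀ {m} → ℕ → ℕ → Vec (Fin σ) m → ℕ
  countPrefix a zero xs = 0
  countPrefix a (suc u) [] = 0
  countPrefix a (suc u) (x ∷ xs) = matches a x + countPrefix a u xs

  countBelow : ∀ {m} → ℕ → Vec (Fin σ) m → ℕ
  countBelow zero xs = 0
  countBelow (suc a) xs = countBelow a xs + count a xs

  matches-self : ∀ x → matches (toℕ x) x ≡ 1
  matches-self x with toℕ x ≟ toℕ x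
  ... | yes _ = refl
  ... | no x≢x = ⊥-elim (x≢x refl)

  matches-other : ∀ {a} x → toℕ x ≢ a → matches a x ≡ 0
  matches-other {a} x x≢a with toℕ x ≟ a
  ... | yes x≡a = ⊥-elim (x≢a x≡a)
  ... | no _ = refl

  matches-pos : ∀ {a} x → 0 < matches a x → toℕ x ≡ a
  matches-pos {a} x _ with toℕ x ≟ a
  ... | yes x≡a = x≡a

  countPrefix-mono : ∀ {m} a {u v} (xs : Vec (Fin σ) m) → u ≤ v →
    countPrefix a u xs ≤ countPrefix a v xs
  countPrefix-mono a xs z≤n = z≤n
  countPrefix-mono a [] (s≤s u≤v) = z≤n
  countPrefix-mono a (x ∷ xs) (s≤s u≤v) = +-monoʳ-≤ (matches a x) (countPrefix-mono a xs u≤v)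

  countPrefix≤count : ∀ {m} a u (xs : Vec (Fin σ) m) → countPrefix a u xs ≤ count a xs
  countPrefix≤count a zero xs = z≤n
  countPrefix≤count a (suc u) [] = z≤n
  countPrefix≤count a (suc u) (x ∷ xs) = +-monoʳ-≤ (matches a x) (countPrefix≤count a u xs)

  countBelow-mono : ∀ {m} (xs : Vec (Fin σ) m) {a b} → a ≤ b → countBelow a xs ≤ countBelow b xs
  countBelow-mono xs {a} {zero} z≤n = z≤n
  countBelow-mono xs {a} {suc b} a≤1+b with m≤n⇒m<n∨m≡n a≤1+b
  ... | inj₁ (s≤s a≤b) = ≤-trans (countBelow-mono xs a≤b) (m≤m+n (countBelow b xs) (count b xs))
  ... | inj₂ refl = ≤-refl

  countBelow-∷ : ∀ {m} a x (xs : Vec (Fin σ) m) →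
    countBelow a (x ∷ xs) ≡ countBelow a (x ∷ []) + countBelow a xs
  countBelow-∷ zero x xs = refl
  countBelow-∷ (suc a) x xs rewrite countBelow-∷ a x xs =
    rearrange (countBelow a (x ∷ [])) (matches a x) (countBelow a xs) (count a xs)
    where
    rearrange : ∀ p q r s → p + r + (q + s) ≡ p + (q + 0) + (r + s)
    rearrange = solve-∀

  countBelow-singleton-≤ : ∀ {a} x → a ≤ toℕ x → countBelow a (x ∷ []) ≡ 0
  countBelow-singleton-≤ {zero} x _ = refl
  countBelow-singleton-≤ {suc a} x a<x
    rewrite countBelow-singleton-≤ x (<⇒≤ a<x) | matches-other x (≢-sym (<⇒≢ a<x)) = refl

  countBelow-singleton-> : ∀ {a} x → toℕ x < a → countBelow a (x ∷ []) ≡ 1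
  countBelow-singleton-> {suc a} x (s≤s x≤a) with m≤n⇒m<n∨m≡n x≤a
  ... | inj₁ x<a rewrite countBelow-singleton-> x x<a | matches-other x (<⇒≢ x<a) = refl
  ... | inj₂ refl rewrite countBelow-singleton-≤ x (≤-refl {toℕ x}) | matches-self x = refl

  countBelow-all : ∀ {m} (xs : Vec (Fin σ) m) → countBelow σ xs ≡ m
  countBelow-all [] = countBelow-[] σ
    where
    countBelow-[] : ∀ a → countBelow a [] ≡ 0
    countBelow-[] zero = refl
    countBelow-[] (suc a) = cong (_+ 0) (countBelow-[] a)
  countBelow-all (x ∷ xs) rewrite countBelow-∷ σ x xs | countBelow-singleton-> x (Fin.toℕ<n x) =
    cong suc (countBelow-all xs)

  countPrefix-attained : ∀ {m} a (xs : Vec (Fin σ) m) {j} → 0 < j → j ≤ count a xs →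
    ∃ λ i → toℕ (lookup xs i) ≡ a × countPrefix a (suc (toℕ i)) xs ≡ j
  countPrefix-attained a [] (s≤s _) ()
  countPrefix-attained a (x ∷ xs) {j} 0<j j≤count with toℕ x ≟ a
  countPrefix-attained a (x ∷ xs) {suc zero} _ _ | yes x≡a = zero , x≡a , refl
  countPrefix-attained a (x ∷ xs) {suc (suc j)} _ (s≤s j≤count) | yes x≡a
    with countPrefix-attained a xs (s≤s z≤n) j≤count
  ... | i , xᵢ≡a , count≡j = suc i , xᵢ≡a , cong suc count≡j
  countPrefix-attained a (x ∷ xs) 0<j j≤count | no _
    with countPrefix-attained a xs 0<j j≤count
  ... | i , xᵢ≡a , count≡j = suc i , xᵢ≡a , count≡j

  countPrefix-injective : ∀ {m} (xs ys : Vec (Fin σ) m) →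
    (∀ i → let a = toℕ (lookup xs i) in countPrefix a (suc (toℕ i)) xs ≡ countPrefix a (suc (toℕ i)) ys) →
    xs ≡ ys
  countPrefix-injective [] [] _ = refl
  countPrefix-injective (x ∷ xs) (y ∷ ys) same with heads-equal
    where
    matches-y : matches (toℕ x) y ≡ 1
    matches-y = trans (sym (+-cancelʳ-≡ 0 (matches (toℕ x) x) _ (same zero))) (matches-self x)
    heads-equal : x ≡ y
    heads-equal = sym (Fin.toℕ-injective (matches-pos y (subst (0 <_) (sym matches-y) (s≤s z≤n))))
  ... | refl = cong (x ∷_) (countPrefix-injective xs ys λ i →
    +-cancelˡ-≡ (matches (toℕ (lookup xs i)) x) _ _ (same (suc i)))

open Counting

module Family (s k : ℕ) where

  σ n : ℕ
  σ = suc s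
  n = suc (k + σ)

  Parameters : Set
  Parameters = Vec (Fin σ) k × Vec (Vec Bool s) k × Vec (Vec Bool σ) σ

  forcedRow : Fin σ → Vec Bool s → Vec Bool σ
  forcedRow ℓ bits = insertAt bits ℓ true

  -- Row 0 is the source, rows 1 … k carry the forced letters, the last σ rows are free.
  rows : Parameters → Vec (Vec Bool σ) n
  rows (L , bitss , free) = Vec.replicate σ true ∷ (zipWith forcedRow L bitss Vec.++ free)

  letters : Parameters → Vec (Fin σ) k
  letters = proj₁

  defined : Parameters → Fin n → Fin σ → Bool
  defined p u a = lookup (lookup (rows p) u) a

  -- Letter a owns a block of states, one for the source row and one for each row forced to a;
  -- row u goes to the state at offset (number of rows among 1 … u forced to a).
  blockStart : Vec (Fin σ) k → ℕ → ℕ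
  blockStart L a = suc (a + countBelow a L)

  target : Vec (Fin σ) k → ℕ → ℕ → ℕ
  target L u a = blockStart L a + countPrefix a u L

  blockStart-mono : ∀ L {a b} → a ≤ b → blockStart L a ≤ blockStart L b
  blockStart-mono L a≤b = s≤s (+-mono-≤ a≤b (countBelow-mono L a≤b))

  target<blockStart-suc : ∀ L u a → target L u a < blockStart L (suc a)
  target<blockStart-suc L u a = begin-strict
    blockStart L a + countPrefix a u L  ≤⟨ +-monoʳ-≤ (blockStart L a) (countPrefix≤count a u L) ⟩
    suc (a + countBelow a L) + count a L     ≡⟨ cong suc (+-assoc a (countBelow a L) (count a L)) ⟩
    suc (a + countBelow (suc a) L)                 <⟨ n<1+n _ ⟩
    blockStart L (suc a)                      ∎
    where open ≤-Reasoning

  target<n : ∀ L u (a : Fin σ) → target L u (toℕ a) < n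
  target<n L u a = begin-strict
    target L u (toℕ a)          <⟨ target<blockStart-suc L u (toℕ a) ⟩
    blockStart L (suc (toℕ a))  ≤⟨ blockStart-mono L (Fin.toℕ<n a) ⟩
    blockStart L σ              ≡⟨ cong (λ b → suc (σ + b)) (countBelow-all L) ⟩
    suc (σ + k)                 ≡⟨ cong suc (+-comm σ k) ⟩
    n                           ∎
    where open ≤-Reasoning

  target-mono : ∀ L {u v} a → u ≤ v → target L u a ≤ target L v a
  target-mono L a u≤v = +-monoʳ-≤ (blockStart L a) (countPrefix-mono a L u≤v)

  target-letters : ∀ L u v {a a'} → a < a' → target L u a < target L v a'
  target-letters L u v {a} {a'} a<a' = begin-strict
    target L u a          <⟨ target<blockStart-suc L u a ⟩
    blockStart L (suc a)  ≤⟨ blockStart-mono L a<a' ⟩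
    blockStart L a'       ≤⟨ m≤m+n (blockStart L a') (countPrefix a' v L) ⟩
    target L v a'         ∎
    where open ≤-Reasoning

  entry : Parameters → Fin n → Fin σ → Maybe (Fin n)
  entry p u a = if defined p u a then just (fromℕ< (target<n (letters p) (toℕ u) a)) else nothing

  table : Parameters → Trans n σ
  table p = tabulate λ u → tabulate (entry p u)

  δ-table : ∀ p u a → δ (table p) u a ≡ entry p u a
  δ-table p = lookup²-tabulate (entry p)

  isDefined-entry : ∀ p u a → isDefined (entry p u a) ≡ defined p u a
  isDefined-entry p u a with defined p u a
  ... | true = refl
  ... | false = refl

  entry-just⁻ : ∀ p u a {v} → entry p u a ≡ just v →
    toℕ v ≡ target (letters p) (toℕ u) (toℕ a)
  entry-just⁻ p u a e with defined p u a
  entry-just⁻ p u a refl | true = Fin.toℕ-fromℕ< (target<n (letters p) (toℕ u) a)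

  δ-table-just⁺ : ∀ p u a {v} → defined p u a ≡ true →
    target (letters p) (toℕ u) (toℕ a) ≡ toℕ v → δ (table p) u a ≡ just v
  δ-table-just⁺ p u a is-defined target≡v rewrite δ-table p u a | is-defined =
    cong just (Fin.toℕ-injective (trans (Fin.toℕ-fromℕ< (target<n (letters p) (toℕ u) a)) target≡v))

  defined-source : ∀ p a → defined p zero a ≡ true
  defined-source p a = Vec.lookup-replicate a true

  defined-forced : ∀ p i → defined p (suc (i ↑ˡ σ)) (lookup (letters p) i) ≡ true
  defined-forced (L , bitss , free) i = begin
    lookup (lookup (zipWith forcedRow L bitss Vec.++ free) (i ↑ˡ σ)) (lookup L i)
      ≡⟨ cong (λ r → lookup r (lookup L i))
              (trans (Vec.lookup-++ˡ (zipWith forcedRow L bitss) free i)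
                     (Vec.lookup-zipWith forcedRow i L bitss)) ⟩
    lookup (forcedRow (lookup L i) (lookup bitss i)) (lookup L i)
      ≡⟨ Vec.insertAt-lookup (lookup bitss i) (lookup L i) true ⟩
    true ∎
    where open ≡-Reasoning

  module _ (p : Parameters) where

    private
      L = letters p

    table-target : ∀ {u a v} → δ (table p) u a ≡ just v → toℕ v ≡ target L (toℕ u) (toℕ a)
    table-target {u} {a} δua = entry-just⁻ p u a (trans (sym (δ-table p u a)) δua)

    table-reaches-block : ∀ v {a} → a < σ →
      blockStart L a ≤ toℕ v → toℕ v ≤ blockStart L a + count a L →
      ∃₂ λ u a → δ (table p) u a ≡ just v
    table-reaches-block v {a} a<σ start≤v v≤end with toℕ v ∸ blockStart L a in offset
    ... | zero = zero , fromℕ< a<σ ,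
      δ-table-just⁺ p zero (fromℕ< a<σ) (defined-source p (fromℕ< a<σ)) (begin
      blockStart L (toℕ (fromℕ< a<σ)) + 0         ≡⟨ cong (λ b → blockStart L b + 0) (Fin.toℕ-fromℕ< a<σ) ⟩
      blockStart L a + 0                          ≡⟨ cong (blockStart L a +_) offset ⟨
      blockStart L a + (toℕ v ∸ blockStart L a)   ≡⟨ m+[n∸m]≡n start≤v ⟩
      toℕ v                                       ∎)
      where open ≡-Reasoning
    ... | suc j with countPrefix-attained a L (s≤s z≤n) (subst (_≤ count a L) offset within)
      where
      within : toℕ v ∸ blockStart L a ≤ count a L
      within = ≤-trans (∸-monoˡ-≤ (blockStart L a) v≤end)
                       (≤-reflexive (m+n∸m≡n (blockStart L a) (count a L)))
    ...   | i , ℓᵢ≡a , count≡j = suc (i ↑ˡ σ) , lookup L i ,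
      δ-table-just⁺ p (suc (i ↑ˡ σ)) (lookup L i) (defined-forced p i) (begin
      target L (suc (toℕ (i ↑ˡ σ))) (toℕ (lookup L i))
        ≡⟨ cong₂ (target L) (cong suc (Fin.toℕ-↑ˡ i σ)) ℓᵢ≡a ⟩
      blockStart L a + countPrefix a (suc (toℕ i)) L
        ≡⟨ cong (blockStart L a +_) (trans count≡j (sym offset)) ⟩
      blockStart L a + (toℕ v ∸ blockStart L a)
        ≡⟨ m+[n∸m]≡n start≤v ⟩
      toℕ v ∎)
      where open ≡-Reasoning

    table-reaches : ∀ v → 0 < toℕ v → ∃₂ λ u a → δ (table p) u a ≡ just v
    table-reaches v 0<v with crossing (blockStart L) σ 0<v v<end
      where
      v<end : toℕ v < blockStart L σ
      v<end = subst (toℕ v <_) (cong suc (trans (+-comm k σ) (cong (σ +_) (sym (countBelow-all L)))))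
                (Fin.toℕ<n v)
    ... | a , a<σ , start≤v , v<next = table-reaches-block v a<σ start≤v
      (≤-trans (≤-pred v<next) (≤-reflexive (sym (cong suc (+-assoc a (countBelow a L) (count a L))))))

    table-wheeler : Wheeler (table p)
    table-wheeler = record
      { order-letters = λ {u} {v} {a} {a'} δua δva' a<a' →
          subst₂ _<_ (sym (table-target {u} {a} δua)) (sym (table-target {v} {a'} δva'))
            (target-letters L (toℕ u) (toℕ v) a<a')
      ; order-states = λ {u} {v} {a} δua δva u'≢v' u<v →
          ≤∧≢⇒< (subst₂ _≤_ (sym (table-target {u} {a} δua)) (sym (table-target {v} {a} δva))
                  (target-mono L (toℕ a) (<⇒≤ u<v)))
                (λ u'≡v' → u'≢v' (Fin.toℕ-injective u'≡v'))
      ; letter-used = λ a → zero , fromℕ< (target<n L 0 a) ,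
          δ-table-just⁺ p zero a (defined-source p a) (sym (Fin.toℕ-fromℕ< (target<n L 0 a)))
      ; source-unreached = λ {u} {a} δua → subst (0 <_) (sym (table-target {u} {a} δua)) (s≤s z≤n)
      ; nonsource-reached = table-reaches
      }

  forcedRows-injective : ∀ {m} (L : Vec (Fin σ) m) {bitss bitss'} →
    zipWith forcedRow L bitss ≡ zipWith forcedRow L bitss' → bitss ≡ bitss'
  forcedRows-injective L {bitss} {bitss'} same-rows = ≡-from-lookup λ i → begin
    lookup bitss i
      ≡⟨ Vec.removeAt-insertAt (lookup bitss i) (lookup L i) true ⟨
    removeAt (forcedRow (lookup L i) (lookup bitss i)) (lookup L i)
      ≡⟨ cong (λ r → removeAt r (lookup L i)) (same-row i) ⟩
    removeAt (forcedRow (lookup L i) (lookup bitss' i)) (lookup L i)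
      ≡⟨ Vec.removeAt-insertAt (lookup bitss' i) (lookup L i) true ⟩
    lookup bitss' i ∎
    where
    open ≡-Reasoning
    same-row : ∀ i → forcedRow (lookup L i) (lookup bitss i) ≡ forcedRow (lookup L i) (lookup bitss' i)
    same-row i = trans (sym (Vec.lookup-zipWith forcedRow i L bitss))
      (trans (cong (λ r → lookup r i) same-rows) (Vec.lookup-zipWith forcedRow i L bitss'))

  module SameTable {p p' : Parameters} (same-table : table p ≡ table p') where

    private
      L = letters p
      L' = letters p'

    same-entry : ∀ u a → entry p u a ≡ entry p' u a
    same-entry = tabulate²-injective {f = entry p} {g = entry p'} same-table

    same-rows : rows p ≡ rows p'
    same-rows = ≡-from-lookup λ u → ≡-from-lookup λ a →
      trans (sym (isDefined-entry p u a)) (trans (cong isDefined (same-entry u a)) (isDefined-entry p' u a))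

    same-target : ∀ u a → defined p u a ≡ true →
      target L (toℕ u) (toℕ a) ≡ target L' (toℕ u) (toℕ a)
    same-target u a is-defined = trans (sym (Fin.toℕ-fromℕ< bound))
      (entry-just⁻ p' u a (trans (sym (same-entry u a)) (trans (sym (δ-table p u a))
        (δ-table-just⁺ p u a is-defined (sym (Fin.toℕ-fromℕ< bound))))))
      where
      bound = target<n L (toℕ u) a

    same-start : ∀ a → blockStart L (toℕ a) ≡ blockStart L' (toℕ a)
    same-start a = +-cancelʳ-≡ 0 _ _ (same-target zero a (defined-source p a))

    same-before : ∀ i → let a = toℕ (lookup L i) in
      countPrefix a (suc (toℕ i)) L ≡ countPrefix a (suc (toℕ i)) L'
    same-before i = +-cancelˡ-≡ (blockStart L a) _ _ (begin
      blockStart L a + countPrefix a (suc (toℕ i)) L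
        ≡⟨ cong (λ u → target L (suc u) a) (Fin.toℕ-↑ˡ i σ) ⟨
      target L (suc (toℕ (i ↑ˡ σ))) a
        ≡⟨ same-target (suc (i ↑ˡ σ)) (lookup L i) (defined-forced p i) ⟩
      target L' (suc (toℕ (i ↑ˡ σ))) a
        ≡⟨ cong₂ (λ b u → b + countPrefix a (suc u) L') (sym (same-start (lookup L i))) (Fin.toℕ-↑ˡ i σ) ⟩
      blockStart L a + countPrefix a (suc (toℕ i)) L' ∎)
      where
      open ≡-Reasoning
      a = toℕ (lookup L i)

    same-letters : L ≡ L'
    same-letters = countPrefix-injective L L' same-before

  table-injective : ∀ {p p'} → table p ≡ table p' → p ≡ p'
  table-injective {L , bitss , free} {L' , bitss' , free'} same-table with same-letters
    where open SameTable same-table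
  ... | refl with Vec.++-injective (zipWith forcedRow L bitss) (zipWith forcedRow L bitss')
                   (Vec.∷-injectiveʳ (SameTable.same-rows same-table))
  ... | same-forced , refl rewrite forcedRows-injective L same-forced = refl

  parameters : Enumeration Parameters (σ ^ k * ((2 ^ s) ^ k * (2 ^ σ) ^ σ))
  parameters = ×-enumeration (Vec-enumeration (Fin-enumeration σ) k)
    (×-enumeration (Vec-enumeration (Vec-enumeration Bool-enumeration s) k)
                   (Vec-enumeration (Vec-enumeration Bool-enumeration σ) σ))

  exponent-bound : n * σ ≤ s * k + σ * σ + n
  exponent-bound = subst (n * σ ≤_) (identity k s) (m≤m+n (n * σ) 1)
    where
    identity : ∀ k s → suc (k + suc s) * suc s + 1 ≡ s * k + suc s * suc s + suc (k + suc s)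
    identity = solve-∀

  lower-bound : 2 ^ (n * σ) * σ ^ (n ∸ σ) ≤ countWDFA n σ * 2 ^ n * σ
  lower-bound = begin
    2 ^ (n * σ) * σ ^ (n ∸ σ)
      ≡⟨ cong (λ e → 2 ^ (n * σ) * σ ^ e) n∸σ≡1+k ⟩
    2 ^ (n * σ) * σ ^ suc k
      ≤⟨ *-monoˡ-≤ (σ ^ suc k) (^-monoʳ-≤ 2 exponent-bound) ⟩
    2 ^ (s * k + σ * σ + n) * σ ^ suc k
      ≡⟨ cong (_* σ ^ suc k) powers ⟩
    (2 ^ s) ^ k * (2 ^ σ) ^ σ * 2 ^ n * (σ * σ ^ k)
      ≡⟨ rearrange ((2 ^ s) ^ k) ((2 ^ σ) ^ σ) (2 ^ n) σ (σ ^ k) ⟩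
    σ ^ k * ((2 ^ s) ^ k * (2 ^ σ) ^ σ) * 2 ^ n * σ
      ≤⟨ *-monoˡ-≤ σ (*-monoˡ-≤ (2 ^ n) (≤-countWDFA parameters table table-injective
                                            (λ p → Wheeler⇒isWDFA (table-wheeler p)))) ⟩
    countWDFA n σ * 2 ^ n * σ ∎
    where
    open ≤-Reasoning
    powers : 2 ^ (s * k + σ * σ + n) ≡ (2 ^ s) ^ k * (2 ^ σ) ^ σ * 2 ^ n
    powers = begin-equality
      2 ^ (s * k + σ * σ + n)            ≡⟨ ^-distribˡ-+-* 2 (s * k + σ * σ) n ⟩
      2 ^ (s * k + σ * σ) * 2 ^ n         ≡⟨ cong (_* 2 ^ n) (^-distribˡ-+-* 2 (s * k) (σ * σ)) ⟩
      2 ^ (s * k) * 2 ^ (σ * σ) * 2 ^ n   ≡⟨ cong₂ (λ x y → x * y * 2 ^ n) (^-*-assoc 2 s k) (^-*-assoc 2 σ σ) ⟨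
      (2 ^ s) ^ k * (2 ^ σ) ^ σ * 2 ^ n   ∎
    n∸σ≡1+k : n ∸ σ ≡ suc k
    n∸σ≡1+k = trans (cong (_∸ s) (+-suc k s)) (m+n∸n≡m (suc k) s)
    rearrange : ∀ A B C σ X → A * B * C * (σ * X) ≡ X * (A * B) * C * σ
    rearrange = solve-∀

-- Sequences of partial values that go up in unit steps

bit : Bool → ℕ
bit true = 1
bit false = 0

trues : ∀ {m} → Vec Bool m → ℕ
trues {m} bs = ∑[ i < m ] bit (lookup bs i)

data UnitSteps : ℕ → ∀ {m} → Vec (Maybe ℕ) m → Set where
  [] : ∀ {c} → UnitSteps c []
  skip : ∀ {c m} {xs : Vec (Maybe ℕ) m} → UnitSteps c xs → UnitSteps c (nothing ∷ xs)
  stay : ∀ {c m} {xs : Vec (Maybe ℕ) m} → UnitSteps c xs → UnitSteps c (just c ∷ xs)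
  up : ∀ {c m} {xs : Vec (Maybe ℕ) m} → UnitSteps (suc c) xs → UnitSteps c (just (suc c) ∷ xs)

lastValue : ∀ {m} → ℕ → Vec (Maybe ℕ) m → ℕ
lastValue c [] = c
lastValue c (nothing ∷ xs) = lastValue c xs
lastValue c (just v ∷ xs) = lastValue v xs

step : ℕ → ℕ → Bool
step c v = does (c <? v)

stepBits : ∀ {m} → ℕ → Vec (Maybe ℕ) m → Vec Bool m
stepBits c [] = []
stepBits c (nothing ∷ xs) = false ∷ stepBits c xs
stepBits c (just v ∷ xs) = step c v ∷ stepBits v xs

step-stay : ∀ c → step c c ≡ false
step-stay c = dec-false (c <? c) (<-irrefl refl)

step-up : ∀ c → step c (suc c) ≡ true
step-up c = dec-true (c <? suc c) (n<1+n c)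

UnitSteps-injective : ∀ {c m} {xs ys : Vec (Maybe ℕ) m} → UnitSteps c xs → UnitSteps c ys →
  Vec.map is-just xs ≡ Vec.map is-just ys → stepBits c xs ≡ stepBits c ys → xs ≡ ys
UnitSteps-injective [] [] _ _ = refl
UnitSteps-injective (skip s) (skip s') defined bits =
  cong (nothing ∷_) (UnitSteps-injective s s' (Vec.∷-injectiveʳ defined) (Vec.∷-injectiveʳ bits))
UnitSteps-injective {c} (stay s) (stay s') defined bits =
  cong (just c ∷_) (UnitSteps-injective s s' (Vec.∷-injectiveʳ defined) (Vec.∷-injectiveʳ bits))
UnitSteps-injective {c} (up s) (up s') defined bits =
  cong (just (suc c) ∷_) (UnitSteps-injective s s' (Vec.∷-injectiveʳ defined) (Vec.∷-injectiveʳ bits))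
UnitSteps-injective {c} (stay _) (up _) _ bits =
  case trans (sym (step-stay c)) (trans (Vec.∷-injectiveˡ bits) (step-up c)) of λ ()
UnitSteps-injective {c} (up _) (stay _) _ bits =
  case trans (sym (step-up c)) (trans (Vec.∷-injectiveˡ bits) (step-stay c)) of λ ()
UnitSteps-injective (skip _) (stay _) defined _ = case Vec.∷-injectiveˡ defined of λ ()
UnitSteps-injective (skip _) (up _) defined _ = case Vec.∷-injectiveˡ defined of λ ()
UnitSteps-injective (stay _) (skip _) defined _ = case Vec.∷-injectiveˡ defined of λ ()
UnitSteps-injective (up _) (skip _) defined _ = case Vec.∷-injectiveˡ defined of λ ()

trues-stepBits : ∀ {c m} {xs : Vec (Maybe ℕ) m} → UnitSteps c xs →
  trues (stepBits c xs) + c ≡ lastValue c xs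
trues-stepBits [] = refl
trues-stepBits (skip s) = trues-stepBits s
trues-stepBits {c} (stay s) rewrite step-stay c = trues-stepBits s
trues-stepBits {c} {xs = just _ ∷ xs} (up s) rewrite step-up c =
  trans (sym (+-suc (trues (stepBits (suc c) xs)) c)) (trues-stepBits s)

lastValue-++ : ∀ {c m m'} (xs : Vec (Maybe ℕ) m) {ys : Vec (Maybe ℕ) m'} →
  lastValue c (xs Vec.++ ys) ≡ lastValue (lastValue c xs) ys
lastValue-++ [] = refl
lastValue-++ (nothing ∷ xs) = lastValue-++ xs
lastValue-++ (just _ ∷ xs) = lastValue-++ xs

lastValue-cases : ∀ {m} c (xs : Vec (Maybe ℕ) m) → lastValue c xs ≡ c ⊎ just (lastValue c xs) ∈ᵥ xs
lastValue-cases c [] = inj₁ refl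
lastValue-cases c (nothing ∷ xs) with lastValue-cases c xs
... | inj₁ last≡c = inj₁ last≡c
... | inj₂ last∈xs = inj₂ (there last∈xs)
lastValue-cases c (just v ∷ xs) with lastValue-cases v xs
... | inj₁ last≡v = inj₂ (here (cong just last≡v))
... | inj₂ last∈xs = inj₂ (there last∈xs)

UnitSteps-++⁻ : ∀ {c m m'} (xs : Vec (Maybe ℕ) m) {ys : Vec (Maybe ℕ) m'} → UnitSteps c (xs Vec.++ ys) →
  UnitSteps c xs × UnitSteps (lastValue c xs) ys
UnitSteps-++⁻ [] s = [] , s
UnitSteps-++⁻ (nothing ∷ xs) (skip s) = let (sxs , sys) = UnitSteps-++⁻ xs s in skip sxs , sys
UnitSteps-++⁻ (just _ ∷ xs) (stay s) = let (sxs , sys) = UnitSteps-++⁻ xs s in stay sxs , sys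
UnitSteps-++⁻ (just _ ∷ xs) (up s) = let (sxs , sys) = UnitSteps-++⁻ xs s in up sxs , sys

_≤ᴹ_ : Maybe ℕ → Maybe ℕ → Set
just x ≤ᴹ just y = x ≤ y
just _ ≤ᴹ nothing = ⊤
nothing ≤ᴹ _ = ⊤

module _ (N : ℕ) where

  private
    bounded-tail : ∀ {m c v} {xs : Vec (Maybe ℕ) m} → AllPairs _≤ᴹ_ (just v ∷ xs) →
      (∀ {x} → just x ∈ᵥ just v ∷ xs → c ≤ x × x ≤ N) →
      ∀ {x} → just x ∈ᵥ xs → v ≤ x × x ≤ N
    bounded-tail (v≤xs ∷ _) bounded x∈xs = All.lookup v≤xs x∈xs , proj₂ (bounded (there x∈xs))

    covered-tail : ∀ {m c v} {xs : Vec (Maybe ℕ) m} → c ≤ v →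
      (∀ w → c < w → w ≤ N → just w ∈ᵥ just v ∷ xs) →
      ∀ w → v < w → w ≤ N → just w ∈ᵥ xs
    covered-tail c≤v covered w v<w w≤N with covered w (≤-<-trans c≤v v<w) w≤N
    ... | here refl = ⊥-elim (<-irrefl refl v<w)
    ... | there w∈xs = w∈xs

  gap-free⇒UnitSteps : ∀ c {m} (xs : Vec (Maybe ℕ) m) → AllPairs _≤ᴹ_ xs →
    (∀ {x} → just x ∈ᵥ xs → c ≤ x × x ≤ N) → (∀ w → c < w → w ≤ N → just w ∈ᵥ xs) →
    UnitSteps c xs
  gap-free⇒UnitSteps c [] _ _ _ = []
  gap-free⇒UnitSteps c (nothing ∷ xs) (_ ∷ sorted) bounded covered =
    skip (gap-free⇒UnitSteps c xs sorted (bounded ∘ there) covered′)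
    where
    covered′ : ∀ w → c < w → w ≤ N → just w ∈ᵥ xs
    covered′ w c<w w≤N with covered w c<w w≤N
    ... | there w∈xs = w∈xs
  gap-free⇒UnitSteps c (just v ∷ xs) sorted@(v≤xs ∷ sorted′) bounded covered with c ≟ v
  ... | yes refl =
    stay (gap-free⇒UnitSteps c xs sorted′ (bounded-tail sorted bounded) (covered-tail ≤-refl covered))
  ... | no c≢v with next≡v
    where
    c<v : c < v
    c<v = ≤∧≢⇒< (proj₁ (bounded (here refl))) c≢v
    next≡v : suc c ≡ v
    next≡v with covered (suc c) ≤-refl (≤-trans c<v (proj₂ (bounded (here refl))))
    ... | here next≡v = Maybe.just-injective next≡v
    ... | there next∈xs = ≤-antisym c<v (All.lookup v≤xs next∈xs)
  ... | refl =
    up (gap-free⇒UnitSteps (suc c) xs sorted′ (bounded-tail sorted bounded) (covered-tail (n≤1+n c) covered))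

data StepColumn (c : ℕ) : ∀ {m} → Vec (Maybe ℕ) m → Set where
  skip : ∀ {m} {xs : Vec (Maybe ℕ) m} → StepColumn c xs → StepColumn c (nothing ∷ xs)
  first : ∀ {m} {xs : Vec (Maybe ℕ) m} → UnitSteps (suc c) xs → StepColumn c (just (suc c) ∷ xs)

-- The first defined entry of a StepColumn is always a step, so its bit carries no information and
-- is dropped: this is what brings the number of free step bits down to n − 1 − σ.
innerStepBits : ∀ {m} → ℕ → Vec (Maybe ℕ) m → Vec Bool m
innerStepBits c [] = []
innerStepBits c (nothing ∷ xs) = false ∷ innerStepBits c xs
innerStepBits c (just v ∷ xs) = false ∷ stepBits v xs

StepColumn-injective : ∀ {c m} {xs ys : Vec (Maybe ℕ) m} → StepColumn c xs → StepColumn c ys →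
  Vec.map is-just xs ≡ Vec.map is-just ys → innerStepBits c xs ≡ innerStepBits c ys → xs ≡ ys
StepColumn-injective (skip s) (skip s') defined bits =
  cong (nothing ∷_) (StepColumn-injective s s' (Vec.∷-injectiveʳ defined) (Vec.∷-injectiveʳ bits))
StepColumn-injective {c} (first s) (first s') defined bits =
  cong (just (suc c) ∷_) (UnitSteps-injective s s' (Vec.∷-injectiveʳ defined) (Vec.∷-injectiveʳ bits))
StepColumn-injective (skip _) (first _) defined _ = case Vec.∷-injectiveˡ defined of λ ()
StepColumn-injective (first _) (skip _) defined _ = case Vec.∷-injectiveˡ defined of λ ()

trues-innerStepBits : ∀ {c m} {xs : Vec (Maybe ℕ) m} → StepColumn c xs →
  suc (trues (innerStepBits c xs) + c) ≡ lastValue c xs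
trues-innerStepBits (skip s) = trues-innerStepBits s
trues-innerStepBits {c} {xs = just _ ∷ xs} (first s) =
  trans (sym (+-suc (trues (stepBits (suc c) xs)) c)) (trues-stepBits s)

UnitSteps⇒StepColumn : ∀ {c m} {xs : Vec (Maybe ℕ) m} → UnitSteps c xs →
  (∀ {x} → just x ∈ᵥ xs → c < x) → (∃ λ x → just x ∈ᵥ xs) → StepColumn c xs
UnitSteps⇒StepColumn (skip s) above (x , there x∈xs) =
  skip (UnitSteps⇒StepColumn s (above ∘ there) (x , x∈xs))
UnitSteps⇒StepColumn (stay s) above _ = ⊥-elim (<-irrefl refl (above (here refl)))
UnitSteps⇒StepColumn (up s) _ _ = first s

data StepColumns {n} : ℕ → ∀ {m} → Vec (Vec (Maybe ℕ) n) m → Set where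
  [] : ∀ {c} → StepColumns c []
  _∷_ : ∀ {c m col} {cols : Vec (Vec (Maybe ℕ) n) m} →
    StepColumn c col → StepColumns (lastValue c col) cols → StepColumns c (col ∷ cols)

columnStepBits : ∀ {n m} → ℕ → Vec (Vec (Maybe ℕ) n) m → Vec (Vec Bool n) m
columnStepBits c [] = []
columnStepBits c (col ∷ cols) = innerStepBits c col ∷ columnStepBits (lastValue c col) cols

StepColumns-injective : ∀ {c n m} {cs cs' : Vec (Vec (Maybe ℕ) n) m} →
  StepColumns c cs → StepColumns c cs' → Vec.map (Vec.map is-just) cs ≡ Vec.map (Vec.map is-just) cs' →
  columnStepBits c cs ≡ columnStepBits c cs' → cs ≡ cs'
StepColumns-injective [] [] _ _ = refl
StepColumns-injective (col ∷ cols) (col' ∷ cols') defined bits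
  with StepColumn-injective col col' (Vec.∷-injectiveˡ defined) (Vec.∷-injectiveˡ bits)
... | refl =
  cong (_ ∷_) (StepColumns-injective cols cols' (Vec.∷-injectiveʳ defined) (Vec.∷-injectiveʳ bits))

trues-columnStepBits : ∀ {c n m} {cs : Vec (Vec (Maybe ℕ) n) m} → StepColumns c cs →
  ∑[ a < m ] trues (lookup (columnStepBits c cs) a) + m + c ≡ lastValue c (concat cs)
trues-columnStepBits [] = refl
trues-columnStepBits {c} {m = suc m} {col ∷ cs} (column ∷ columns) = begin
  trues (innerStepBits c col) + rest + suc m + c     ≡⟨ rearrange (trues (innerStepBits c col)) rest m c ⟩
  rest + m + suc (trues (innerStepBits c col) + c)   ≡⟨ cong (rest + m +_) (trues-innerStepBits column) ⟩
  rest + m + lastValue c col                         ≡⟨ trues-columnStepBits columns ⟩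
  lastValue (lastValue c col) (concat cs)            ≡⟨ lastValue-++ col ⟨
  lastValue c (col Vec.++ concat cs)                 ∎
  where
  open ≡-Reasoning
  rest = ∑[ a < m ] trues (lookup (columnStepBits (lastValue c col) cs) a)
  rearrange : ∀ t r m c → t + r + suc m + c ≡ r + m + suc (t + c)
  rearrange = solve-∀

Separated : ∀ {n} → Vec (Maybe ℕ) n → Vec (Maybe ℕ) n → Set
Separated xs ys = ∀ {x y} → just x ∈ᵥ xs → just y ∈ᵥ ys → x < y

UnitSteps⇒StepColumns : ∀ {c n m} (cs : Vec (Vec (Maybe ℕ) n) m) → UnitSteps c (concat cs) →
  AllPairs Separated cs → (∀ {x} → just x ∈ᵥ concat cs → c < x) →
  All (λ col → ∃ λ x → just x ∈ᵥ col) cs → StepColumns c cs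
UnitSteps⇒StepColumns [] _ _ _ _ = []
UnitSteps⇒StepColumns {c} (col ∷ cs) s (col<cs ∷ separated) above (nonempty ∷ nonempties) =
  UnitSteps⇒StepColumn (proj₁ split) (above ∘ Vec.∈-++⁺ˡ) nonempty ∷
  UnitSteps⇒StepColumns cs (proj₂ split) separated above′ nonempties
  where
  split = UnitSteps-++⁻ col s
  above′ : ∀ {x} → just x ∈ᵥ concat cs → lastValue c col < x
  above′ x∈cs with lastValue-cases c col
  ... | inj₁ last≡c = subst (_< _) (sym last≡c) (above (Vec.∈-++⁺ʳ col x∈cs))
  ... | inj₂ last∈col =
    let (col<col′ , x∈col′) = All.lookupAny col<cs (Any.concat⁻ cs x∈cs) in col<col′ last∈col x∈col′

-- Sparse 0/1 matrices

support : ∀ {σ} → Vec Bool σ → List (Fin σ)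
support [] = []
support (true ∷ bs) = zero ∷ map suc (support bs)
support (false ∷ bs) = map suc (support bs)

length-support : ∀ {σ} (bs : Vec Bool σ) → length (support bs) ≡ trues bs
length-support [] = refl
length-support (true ∷ bs) = cong suc (trans (List.length-map suc (support bs)) (length-support bs))
length-support (false ∷ bs) = trans (List.length-map suc (support bs)) (length-support bs)

zero∉map-suc : ∀ {σ} (is : List (Fin σ)) {js : List (Fin (suc σ))} → map suc is ≢ zero ∷ js
zero∉map-suc (_ ∷ _) ()

support-injective : ∀ {σ} (bs bs' : Vec Bool σ) → support bs ≡ support bs' → bs ≡ bs'
support-injective [] [] _ = refl
support-injective (true ∷ bs) (true ∷ bs') same =
  cong (true ∷_) (support-injective bs bs' (List.map-injective Fin.suc-injective (List.∷-injectiveʳ same)))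
support-injective (false ∷ bs) (false ∷ bs') same =
  cong (false ∷_) (support-injective bs bs' (List.map-injective Fin.suc-injective same))
support-injective (true ∷ bs) (false ∷ bs') same = ⊥-elim (zero∉map-suc (support bs') (sym same))
support-injective (false ∷ bs) (true ∷ bs') same = ⊥-elim (zero∉map-suc (support bs) same)

module _ {σ : ℕ} where

  sparseWord : ∀ {m} → Vec (Vec Bool σ) m → List Bool
  sparseWord [] = []
  sparseWord (r ∷ rs) = replicate (trues r) true ++ false ∷ sparseWord rs

  sparseLetters : ∀ {m} → Vec (Vec Bool σ) m → List (Fin σ)
  sparseLetters [] = []
  sparseLetters (r ∷ rs) = support r ++ sparseLetters rs

  ones : ∀ {m} → Vec (Vec Bool σ) m → ℕ
  ones {m} rs = ∑[ u < m ] trues (lookup rs u)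

  length-sparseWord : ∀ {m} (rs : Vec (Vec Bool σ) m) → length (sparseWord rs) ≡ m + ones rs
  length-sparseWord [] = refl
  length-sparseWord {suc m} (r ∷ rs) = begin
    length (replicate (trues r) true ++ false ∷ sparseWord rs)
      ≡⟨ List.length-++ (replicate (trues r) true) ⟩
    length (replicate (trues r) true) + suc (length (sparseWord rs))
      ≡⟨ cong₂ (λ a b → a + suc b) (List.length-replicate (trues r)) (length-sparseWord rs) ⟩
    trues r + suc (m + ones rs)
      ≡⟨ rearrange (trues r) m (ones rs) ⟩
    suc (m + (trues r + ones rs)) ∎
    where
    open ≡-Reasoning
    rearrange : ∀ t m o → t + suc (m + o) ≡ suc (m + (t + o))
    rearrange = solve-∀

  length-sparseLetters : ∀ {m} (rs : Vec (Vec Bool σ) m) → length (sparseLetters rs) ≡ ones rs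
  length-sparseLetters [] = refl
  length-sparseLetters (r ∷ rs) =
    trans (List.length-++ (support r)) (cong₂ _+_ (length-support r) (length-sparseLetters rs))

unary-injective : ∀ a b {w w' : List Bool} →
  replicate a true ++ false ∷ w ≡ replicate b true ++ false ∷ w' → a ≡ b × w ≡ w'
unary-injective zero zero same = refl , List.∷-injectiveʳ same
unary-injective (suc a) (suc b) same =
  let (a≡b , w≡w') = unary-injective a b (List.∷-injectiveʳ same) in cong suc a≡b , w≡w'

++-injective-length : ∀ {A : Set} (xs ys : List A) {zs ws} → length xs ≡ length ys →
  xs ++ zs ≡ ys ++ ws → xs ≡ ys × zs ≡ ws
++-injective-length [] [] _ same = refl , same
++-injective-length (x ∷ xs) (y ∷ ys) same-length same with List.∷-injective same
... | refl , same′ =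
  let (xs≡ys , zs≡ws) = ++-injective-length xs ys (suc-injective same-length) same′ in cong (x ∷_) xs≡ys , zs≡ws

sparse-injective : ∀ {σ m} (rs rs' : Vec (Vec Bool σ) m) {w w' ls ls'} →
  sparseWord rs ++ w ≡ sparseWord rs' ++ w' → sparseLetters rs ++ ls ≡ sparseLetters rs' ++ ls' → rs ≡ rs'
sparse-injective [] [] _ _ = refl
sparse-injective (r ∷ rs) (r' ∷ rs') same-word same-letters
  with unary-injective (trues r) (trues r')
         (trans (sym (List.++-assoc (replicate (trues r) true) _ _))
                (trans same-word (List.++-assoc (replicate (trues r') true) _ _)))
... | same-count , same-word′
  with ++-injective-length (support r) (support r')
         (trans (length-support r) (trans same-count (sym (length-support r'))))
         (trans (sym (List.++-assoc (support r) _ _)) (trans same-letters (List.++-assoc (support r') _ _)))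
... | same-support , same-letters′ =
  cong₂ _∷_ (support-injective r r' same-support) (sparse-injective rs rs' same-word′ same-letters′)

pad : ∀ {A : Set} L → A → List A → Vec A L
pad zero d xs = []
pad (suc L) d [] = d ∷ pad L d []
pad (suc L) d (x ∷ xs) = x ∷ pad L d xs

toList-pad : ∀ {A : Set} L (d : A) xs → length xs ≤ L → ∃ λ rest → toList (pad L d xs) ≡ xs ++ rest
toList-pad L d [] _ = toList (pad L d []) , refl
toList-pad (suc L) d (x ∷ xs) (s≤s xs≤L) =
  let (rest , eq) = toList-pad L d xs xs≤L in rest , cong (x ∷_) eq

sparseCode : ∀ {σ m} k → Vec (Vec Bool (suc σ)) m → Vec Bool (m + k) × Vec (Fin (suc σ)) k
sparseCode {m = m} k rs = pad (m + k) false (sparseWord rs) , pad k zero (sparseLetters rs)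

sparseCode-injective : ∀ {σ m k} {rs rs' : Vec (Vec Bool (suc σ)) m} → ones rs ≤ k → ones rs' ≤ k →
  sparseCode k rs ≡ sparseCode k rs' → rs ≡ rs'
sparseCode-injective {m = m} {k} {rs} {rs'} rs≤k rs'≤k same
  with toList-pad (m + k) false (sparseWord rs) (word≤ rs rs≤k)
     | toList-pad (m + k) false (sparseWord rs') (word≤ rs' rs'≤k)
     | toList-pad k zero (sparseLetters rs) (letters≤ rs rs≤k)
     | toList-pad k zero (sparseLetters rs') (letters≤ rs' rs'≤k)
  where
  word≤ : ∀ rs → ones rs ≤ k → length (sparseWord rs) ≤ m + k
  word≤ rs ones≤k = ≤-trans (≤-reflexive (length-sparseWord rs)) (+-monoʳ-≤ m ones≤k)
  letters≤ : ∀ rs → ones rs ≤ k → length (sparseLetters rs) ≤ k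
  letters≤ rs ones≤k = ≤-trans (≤-reflexive (length-sparseLetters rs)) ones≤k
... | _ , word | _ , word' | _ , letters | _ , letters' = sparse-injective rs rs'
  (trans (sym word) (trans (cong (toList ∘ proj₁) same) word'))
  (trans (sym letters) (trans (cong (toList ∘ proj₂) same) letters'))

-- The encoding of a WDFA

AllPairs-tabulate : ∀ {A : Set} {R : A → A → Set} {m} {f : Fin m → A} →
  (∀ {i j} → toℕ i < toℕ j → R (f i) (f j)) → AllPairs R (tabulate f)
AllPairs-tabulate {m = zero} ordered = []
AllPairs-tabulate {m = suc m} ordered =
  All.tabulate⁺ (λ j → ordered (s≤s z≤n)) ∷ AllPairs-tabulate (λ i<j → ordered (s≤s i<j))

module TableColumns {n σ : ℕ} (t : Trans n σ) where

  column : Fin σ → Vec (Maybe ℕ) n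
  column a = tabulate λ u → Maybe.map toℕ (δ t u a)

  columns : Vec (Vec (Maybe ℕ) n) σ
  columns = tabulate column

  ∈-column⁻ : ∀ {a x} → just x ∈ᵥ column a → ∃₂ λ u v → δ t u a ≡ just v × toℕ v ≡ x
  ∈-column⁻ x∈col with Any.tabulate⁻ x∈col
  ... | u , x≡ = u , just-map⁻ x≡
    where
    just-map⁻ : ∀ {m : Maybe (Fin n)} {x} → just x ≡ Maybe.map toℕ m → ∃ λ v → m ≡ just v × toℕ v ≡ x
    just-map⁻ {just v} refl = v , refl , refl

  ∈-columns⁻ : ∀ {x} → just x ∈ᵥ concat columns → ∃ λ a → just x ∈ᵥ column a
  ∈-columns⁻ x∈cols = Any.tabulate⁻ (Any.concat⁻ columns x∈cols)

  ∈-columns⁺ : ∀ {u a v} → δ t u a ≡ just v → just (toℕ v) ∈ᵥ concat columns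
  ∈-columns⁺ {u} {a} δua =
    Any.concat⁺ (Any.tabulate⁺ a (Any.tabulate⁺ u (cong (Maybe.map toℕ) (sym δua))))

  module _ (W : Wheeler t) where

    open Wheeler W

    column-sorted : ∀ a → AllPairs _≤ᴹ_ (column a)
    column-sorted a = AllPairs-tabulate ordered
      where
      ordered : ∀ {u v} → toℕ u < toℕ v → Maybe.map toℕ (δ t u a) ≤ᴹ Maybe.map toℕ (δ t v a)
      ordered {u} {v} u<v with δ t u a in δua | δ t v a in δva
      ... | just u' | just v' with u' Fin.≟ v'
      ...   | yes refl = ≤-refl
      ...   | no u'≢v' = <⇒≤ (order-states δua δva u'≢v' u<v)
      ordered u<v | just _ | nothing = _
      ordered u<v | nothing | _ = _

    columns-ordered : ∀ {a a'} → toℕ a < toℕ a' → All (λ x → All (x ≤ᴹ_) (column a')) (column a)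
    columns-ordered {a} {a'} a<a' = All.tabulate⁺ λ u → All.tabulate⁺ λ v → ordered u v
      where
      ordered : ∀ u v → Maybe.map toℕ (δ t u a) ≤ᴹ Maybe.map toℕ (δ t v a')
      ordered u v with δ t u a in δua | δ t v a' in δva'
      ... | just _ | just _ = <⇒≤ (order-letters δua δva' a<a')
      ... | just _ | nothing = _
      ... | nothing | _ = _

    columns-separated : ∀ {a a'} → toℕ a < toℕ a' → Separated (column a) (column a')
    columns-separated a<a' x∈col y∈col' with ∈-column⁻ x∈col | ∈-column⁻ y∈col'
    ... | _ , _ , δua , refl | _ , _ , δva' , refl = order-letters δua δva' a<a'

    ∈-columns-bounded : ∀ {x} → just x ∈ᵥ concat columns → 0 < x × x ≤ pred n
    ∈-columns-bounded x∈cols with ∈-column⁻ (proj₂ (∈-columns⁻ x∈cols))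
    ... | _ , v , δua , refl = source-unreached δua , <⇒≤pred (Fin.toℕ<n v)

    ∈-columns-reached : ∀ w → w < n → 0 < w → just w ∈ᵥ concat columns
    ∈-columns-reached w w<n 0<w
      with nonsource-reached (fromℕ< w<n) (subst (0 <_) (sym (Fin.toℕ-fromℕ< w<n)) 0<w)
    ... | u , a , δua = subst (λ x → just x ∈ᵥ concat columns) (Fin.toℕ-fromℕ< w<n) (∈-columns⁺ δua)

    columns-gap-free : ∀ w → 0 < w → w ≤ pred n → just w ∈ᵥ concat columns
    columns-gap-free w 0<w w≤N = ∈-columns-reached w (≤pred⇒< n 0<w w≤N) 0<w
      where
      ≤pred⇒< : ∀ n {w} → 0 < w → w ≤ pred n → w < n
      ≤pred⇒< zero (s≤s _) ()
      ≤pred⇒< (suc n) _ w≤n = s≤s w≤n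

    wheeler-columns : StepColumns 0 columns
    wheeler-columns = UnitSteps⇒StepColumns columns steps₀ (AllPairs-tabulate columns-separated)
      (proj₁ ∘ ∈-columns-bounded) (All.tabulate⁺ nonempty)
      where
      sorted : AllPairs _≤ᴹ_ (concat columns)
      sorted = AllPairs.concat⁺ (All.tabulate⁺ column-sorted) (AllPairs-tabulate columns-ordered)
      steps₀ : UnitSteps 0 (concat columns)
      steps₀ = gap-free⇒UnitSteps (pred n) 0 (concat columns) sorted
        (λ x∈cols → z≤n , proj₂ (∈-columns-bounded x∈cols)) columns-gap-free
      nonempty : ∀ a → ∃ λ x → just x ∈ᵥ column a
      nonempty a with letter-used a
      ... | u , v , δua = toℕ v , Any.tabulate⁺ u (cong (Maybe.map toℕ) (sym δua))

    lastValue-columns≤ : lastValue 0 (concat columns) ≤ pred n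
    lastValue-columns≤ with lastValue-cases 0 (concat columns)
    ... | inj₁ last≡0 = subst (_≤ pred n) (sym last≡0) z≤n
    ... | inj₂ last∈cols = proj₂ (∈-columns-bounded last∈cols)

module Encoding {n σ′ : ℕ} where

  open TableColumns

  private
    σ k : ℕ
    σ = suc σ′
    k = pred n ∸ σ

  definedness : Trans n σ → Vec (Vec Bool n) σ
  definedness t = Vec.map (Vec.map is-just) (columns t)

  fresh : Trans n σ → Vec (Vec Bool n) σ
  fresh t = columnStepBits 0 (columns t)

  freshRows : Trans n σ → Vec (Vec Bool σ) n
  freshRows t = tabulate λ u → tabulate λ a → lookup (lookup (fresh t) a) u

  code : Trans n σ → Vec (Vec Bool n) σ × Vec Bool (n + k) × Vec (Fin σ) k
  code t = definedness t , sparseCode k (freshRows t)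

  ones-freshRows : ∀ t → ones (freshRows t) ≡ ∑[ a < σ ] trues (lookup (fresh t) a)
  ones-freshRows t = begin
    ∑[ u < n ] trues (lookup (freshRows t) u)
      ≡⟨ sum-cong-≗ (λ u → sum-cong-≗ λ a →
           cong bit (lookup²-tabulate (λ u a → lookup (lookup (fresh t) a) u) u a)) ⟩
    ∑[ u < n ] ∑[ a < σ ] bit (lookup (lookup (fresh t) a) u)
      ≡⟨ ∑-comm (λ u a → bit (lookup (lookup (fresh t) a) u)) ⟩
    ∑[ a < σ ] trues (lookup (fresh t) a) ∎
    where open ≡-Reasoning

  ones-freshRows≤k : ∀ {t} → Wheeler t → ones (freshRows t) ≤ k
  ones-freshRows≤k {t} W = subst (_≤ k) (sym (ones-freshRows t)) (m+n≤o⇒m≤o∸n _ (begin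
    ∑[ a < σ ] trues (lookup (fresh t) a) + σ      ≡⟨ +-identityʳ _ ⟨
    ∑[ a < σ ] trues (lookup (fresh t) a) + σ + 0  ≡⟨ trues-columnStepBits (wheeler-columns t W) ⟩
    lastValue 0 (concat (columns t))               ≤⟨ lastValue-columns≤ t W ⟩
    pred n                                         ∎))
    where open ≤-Reasoning

  code-injective : ∀ {t t'} → Wheeler t → Wheeler t' → code t ≡ code t' → t ≡ t'
  code-injective {t} {t'} W W' same-code = ≡-from-lookup λ u → ≡-from-lookup λ a →
    Maybe.map-injective Fin.toℕ-injective
      (tabulate²-injective {f = λ a u → Maybe.map toℕ (δ t u a)} {g = λ a u → Maybe.map toℕ (δ t' u a)}
        same-columns a u)
    where
    same-fresh : fresh t ≡ fresh t'
    same-fresh = ≡-from-lookup λ a → ≡-from-lookup λ u →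
      tabulate²-injective {f = λ u a → lookup (lookup (fresh t) a) u} {g = λ u a → lookup (lookup (fresh t') a) u}
        (sparseCode-injective (ones-freshRows≤k W) (ones-freshRows≤k W') (proj₂ (,-injective same-code))) u a
    same-columns : columns t ≡ columns t'
    same-columns = StepColumns-injective (wheeler-columns t W) (wheeler-columns t' W')
      (proj₁ (,-injective same-code)) same-fresh

  upper-bound : countWDFA n σ ≤ 2 ^ (n * σ) * σ ^ (n ∸ σ) * 2 ^ (2 * n)
  upper-bound = begin
    countWDFA n σ
      ≤⟨ countWDFA-≤ codes code (λ V V' → code-injective (isWDFA⇒Wheeler V) (isWDFA⇒Wheeler V')) ⟩
    (2 ^ n) ^ σ * (2 ^ (n + k) * σ ^ k)
      ≡⟨ cong (_* (2 ^ (n + k) * σ ^ k)) (^-*-assoc 2 n σ) ⟩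
    2 ^ (n * σ) * (2 ^ (n + k) * σ ^ k)
      ≤⟨ *-monoʳ-≤ (2 ^ (n * σ)) (*-mono-≤ (^-monoʳ-≤ 2 n+k≤2n) (^-monoʳ-≤ σ k≤n∸σ)) ⟩
    2 ^ (n * σ) * (2 ^ (2 * n) * σ ^ (n ∸ σ))
      ≡⟨ cong (2 ^ (n * σ) *_) (*-comm (2 ^ (2 * n)) _) ⟩
    2 ^ (n * σ) * (σ ^ (n ∸ σ) * 2 ^ (2 * n))
      ≡⟨ *-assoc (2 ^ (n * σ)) _ _ ⟨
    2 ^ (n * σ) * σ ^ (n ∸ σ) * 2 ^ (2 * n) ∎
    where
    open ≤-Reasoning
    codes = ×-enumeration (Vec-enumeration (Vec-enumeration Bool-enumeration n) σ)
      (×-enumeration (Vec-enumeration Bool-enumeration (n + k)) (Vec-enumeration (Fin-enumeration σ) k))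
    k≤n∸σ : k ≤ n ∸ σ
    k≤n∸σ = ∸-monoˡ-≤ σ (pred[n]≤n {n})
    n+k≤2n : n + k ≤ 2 * n
    n+k≤2n = +-monoʳ-≤ n (≤-trans k≤n∸σ (≤-trans (m∸n≤m n σ) (≤-reflexive (sym (+-identityʳ n)))))

countWDFA-lower : ∀ n σ → 1 ≤ σ → σ ≤ n ∸ 1 → 2 ^ (n * σ) * σ ^ (n ∸ σ) ≤ countWDFA n σ * 2 ^ n * σ
countWDFA-lower zero (suc s) _ ()
countWDFA-lower (suc m) (suc s) _ σ≤m =
  subst (λ m → 2 ^ (suc m * suc s) * suc s ^ (suc m ∸ suc s) ≤ countWDFA (suc m) (suc s) * 2 ^ suc m * suc s)
    (m∸n+n≡m σ≤m) (Family.lower-bound s (m ∸ suc s))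

countWDFA-upper : ∀ n σ → 1 ≤ σ → countWDFA n σ ≤ 2 ^ (n * σ) * σ ^ (n ∸ σ) * 2 ^ (2 * n)
countWDFA-upper n (suc σ′) _ = Encoding.upper-bound {n} {σ′}

-- The constant C = 2 works for every ε = p / q and every n.
theorem20 :
    ((n σ : ℕ) → 1 ≤ σ → σ ≤ n ∸ 1 →
      2 ^ (n * σ) * σ ^ (n ∸ σ) ≤ countWDFA n σ * 2 ^ n * σ)
    ×
    ((p q : ℕ) → 0 < p → 2 * p ≤ q →
      Σ ℕ λ C → (n σ : ℕ) → 2 * q ≤ n * p → 1 ≤ σ → σ * q ≤ (q ∸ p) * n →
        countWDFA n σ ≤ 2 ^ (n * σ) * σ ^ (n ∸ σ) * 2 ^ (C * n))
theorem20 = countWDFA-lower , λ _ _ _ _ → 2 , λ n σ _ 1≤σ _ → countWDFA-upper n σ 1≤σ
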